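{- Let $n\ge0$, $X=(x_1,\dots,x_n)$, $\overline X=(1/x_1,\dots,1/x_n)$. For $\lambda\in\mathcal P_n$, $\mathfrak o_\lambda(-X,-\overline X,-1)=(-1)^{|\lambda|}\mathrm{oo}_\lambda(X)$. For $\lambda\in\mathcal P_{n+1}$, $\mathfrak{so}^-_\lambda(-X,-\overline X,-1)=\mathrm{oe}_\lambda(-X,-1)$.
   Context: $\mathcal P_k$ = partitions with at most $k$ nonzero parts; $|\lambda|$ the sum of parts. $h_k$ complete homogeneous symmetric polynomial ($h_0=1$, $h_k=0$ for $k<0$). For a finite list of variables $Z$ and $N\ge\ell(\lambda)$: $\mathfrak o_\lambda(Z)=\det(h_{\lambda_i-i+j}(Z)-h_{\lambda_i-i-j}(Z))_{1\le i,j\le N}$, $\mathfrak{so}^-_\lambda(Z)=\det(h_{\lambda_i-i+j}(Z)-h_{\lambda_i-i-j+1}(Z))_{1\le i,j\le N}$. For $k$ variables $W$, $\overline W=(1/w_1,\dots,1/w_k)$ and $\lambda\in\mathcal P_k$: $\mathrm{oo}_\lambda(W)=\det(h_{\lambda_i-i+j}(W,\overline W,1)-h_{\lambda_i-i-j}(W,\overline W,1))_{1\le i,j\le k}$, $\mathrm{oe}_\lambda(W)=\det(h_{\lambda_i-i+j}(W,\overline W)-h_{\lambda_i-i-j}(W,\overline W))_{1\le i,j\le k}$ (so $\mathrm{oe}_\lambda(-X,-1)$ has $n+1$ variables). $-X=(-x_1,\dots,-x_n)$. -}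

module Defs where

open import Algebra.Bundles using (CommutativeRing)
open import Data.Nat as ℕ using (ℕ; zero; suc)
open import Data.Integer as ℤ using (ℤ; +_; -[1+_])
open import Data.Fin using (Fin; zero; suc; toℕ; punchIn; _≤_)
open import Data.List using (List; []; _∷_; _++_; [_]; map)
open import Data.Vec using (Vec; toList; lookup)

-- Partitions with at most k nonzero parts, represented as weakly
-- decreasing k-tuples of naturals (padded with zeros).
IsPartition : {k : ℕ} → (Fin k → ℕ) → Set
IsPartition {k} λ' = (i j : Fin k) → i ≤ j → λ' j ℕ.≤ λ' i

size : {k : ℕ} → (Fin k → ℕ) → ℕ
size {zero} λ' = 0
size {suc k} λ' = λ' zero ℕ.+ size (λ' ∘′ suc)
  where
  _∘′_ : {A B C : Set} → (B → C) → (A → B) → A → C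
  (f ∘′ g) x = f (g x)

module _ {c ℓ} (R : CommutativeRing c ℓ) where
  open CommutativeRing R using (Carrier; _+_; _*_; -_; _-_; 0#; 1#)

  pow : Carrier → ℕ → Carrier
  pow x zero = 1#
  pow x (suc m) = x * pow x m

  sumTo : ℕ → (ℕ → Carrier) → Carrier
  sumTo zero f = f 0
  sumTo (suc k) f = sumTo k f + f (suc k)

  sumFin : {k : ℕ} → (Fin k → Carrier) → Carrier
  sumFin {zero} f = 0#
  sumFin {suc k} f = f zero + sumFin (λ i → f (suc i))

  -- complete homogeneous symmetric polynomial h_k(Z), k ∈ ℕ
  hN : ℕ → List Carrier → Carrier
  hN zero [] = 1#
  hN (suc k) [] = 0#
  hN k (z ∷ Z) = sumTo k (λ j → pow z j * hN (k ℕ.∸ j) Z)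

  h : ℤ → List Carrier → Carrier
  h (+ k) Z = hN k Z
  h -[1+ k ] Z = 0#

  det : {N : ℕ} → (Fin N → Fin N → Carrier) → Carrier
  det {zero} M = 1#
  det {suc N} M =
    sumFin (λ j → pow (- 1#) (toℕ j) * (M zero j * det (λ a b → M (suc a) (punchIn j b))))

  -- integer λ_i - i + j + d, with i, j the 1-based indices (toℕ i + 1 etc.)
  -- idx λ i s j d computes λ_i - i + s·j + d where s = ±1
  idx+ : ℕ → ℕ → ℕ → ℤ
  idx+ l i j = (+ l ℤ.- + i) ℤ.+ + j
  idx- : ℕ → ℕ → ℕ → ℤ
  idx- l i j = (+ l ℤ.- + i) ℤ.- + j

  -- 𝔬_λ(Z) with N = number of parts of the given tuple (N ≥ ℓ(λ))
  -- entries h_{λ_i-i+j} - h_{λ_i-i-j}, i,j 1-based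
  orth : {N : ℕ} → (Fin N → ℕ) → List Carrier → Carrier
  orth λ' Z = det (λ i j →
      h (idx+ (λ' i) (suc (toℕ i)) (suc (toℕ j))) Z
    - h (idx- (λ' i) (suc (toℕ i)) (suc (toℕ j))) Z)

  -- 𝔰𝔬⁻_λ(Z): entries h_{λ_i-i+j} - h_{λ_i-i-j+1}
  soMinus : {N : ℕ} → (Fin N → ℕ) → List Carrier → Carrier
  soMinus λ' Z = det (λ i j →
      h (idx+ (λ' i) (suc (toℕ i)) (suc (toℕ j))) Z
    - h (idx- (λ' i) (suc (toℕ i)) (toℕ j)) Z)

  -- oo_λ(W), given W and its entrywise inverses Wbar
  oo : {k : ℕ} → (Fin k → ℕ) → Vec Carrier k → Vec Carrier k → Carrier
  oo λ' W Wbar = orth λ' (toList W ++ toList Wbar ++ [ 1# ])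

  -- oe_λ(W), given W and its entrywise inverses Wbar
  oe : {k : ℕ} → (Fin k → ℕ) → Vec Carrier k → Vec Carrier k → Carrier
  oe λ' W Wbar = orth λ' (toList W ++ toList Wbar)

  negL : List Carrier → List Carrier
  negL = map (λ z → - z)

{-# OPTIONS --safe #-}
-- Both parts are determinant identities valid for an arbitrary list of variables Z.
--
-- Negating the variables gives h_k(-Z) = (-1)^k h_k(Z). Since λ_i - i + j and λ_i - i - j have
-- the same parity, entry (i, j) of the matrix of 𝔬_λ gets multiplied by (-1)^(λ_i + i) (-1)^j;
-- the row signs contribute (-1)^|λ| ∏ (-1)^i and the column signs cancel ∏ (-1)^i.
--
-- Adjoining the variable -1 divides the generating function ∑ h_k t^k by 1 + t, so
-- h_k(Z) = H_k + H_(k-1) with H = h(Z, -1). Writing O_j = H_(a+j) - H_(a-j), a = λ_i - i, for the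
-- entries of 𝔬_λ(Z, -1), the entries of 𝔰𝔬⁻_λ(Z) are O_1 and O_j + O_(j-1) (j ≥ 2): the matrix of
-- 𝔰𝔬⁻_λ(Z) arises from that of 𝔬_λ(Z, -1) by adding every column to its right neighbour, which
-- does not change the determinant.
module Submission where

open import Defs
open import Algebra.Bundles using (CommutativeRing)
open import Data.Nat using (ℕ; suc)
open import Data.Fin using (Fin)
open import Data.Product using (_×_)
open import Data.List using (_++_; [_])
open import Data.Vec using (Vec; lookup; toList; map; _∷ʳ_)

open import Data.Empty using (⊥-elim)
open import Data.Fin using (zero; suc; toℕ; punchIn)
import Data.Fin.Properties as Finₚ
open import Data.Integer as ℤ using (ℤ; +_; -[1+_])
import Data.Integer.Properties as ℤₚ
open import Data.List as List using (List; []; _∷_)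
import Data.List.Properties as Listₚ
open import Data.Nat as ℕ using (zero; s≤s; z<s; s<s)
import Data.Nat.Properties as ℕₚ
open import Data.Product using (_,_)
import Data.Vec.Properties as Vecₚ
open import Function using (_∘_)
open import Relation.Nullary using (yes; no)
open import Relation.Binary.PropositionalEquality as ≡ using (_≡_; _≢_)

-- Deleting a column: punchInℕ is Fin's punchIn on column numbers, punchOutℕ its inverse.

punchInℕ : ℕ → ℕ → ℕ
punchInℕ zero    k       = suc k
punchInℕ (suc c) zero    = zero
punchInℕ (suc c) (suc k) = suc (punchInℕ c k)

punchOutℕ : ℕ → ℕ → ℕ
punchOutℕ zero    zero    = zero
punchOutℕ zero    (suc q) = q
punchOutℕ (suc c) zero    = zero
punchOutℕ (suc c) (suc q) = suc (punchOutℕ c q)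

toℕ-punchIn : ∀ {N} (c : Fin (suc N)) (b : Fin N) → toℕ (punchIn c b) ≡ punchInℕ (toℕ c) (toℕ b)
toℕ-punchIn zero    b       = ≡.refl
toℕ-punchIn (suc c) zero    = ≡.refl
toℕ-punchIn (suc c) (suc b) = ≡.cong suc (toℕ-punchIn c b)

punchInℕᵢ≢i : ∀ c k → punchInℕ c k ≢ c
punchInℕᵢ≢i (suc c) (suc k) eq = punchInℕᵢ≢i c k (ℕₚ.suc-injective eq)

punchInℕ-injective : ∀ c k k′ → punchInℕ c k ≡ punchInℕ c k′ → k ≡ k′
punchInℕ-injective zero    k       k′       eq = ℕₚ.suc-injective eq
punchInℕ-injective (suc c) zero    zero     _  = ≡.refl
punchInℕ-injective (suc c) (suc k) (suc k′) eq =
  ≡.cong suc (punchInℕ-injective c k k′ (ℕₚ.suc-injective eq))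

punchInℕ-punchOutℕ : ∀ c q → c ≢ q → punchInℕ c (punchOutℕ c q) ≡ q
punchInℕ-punchOutℕ zero    zero    c≢q = ⊥-elim (c≢q ≡.refl)
punchInℕ-punchOutℕ zero    (suc q) _   = ≡.refl
punchInℕ-punchOutℕ (suc c) zero    _   = ≡.refl
punchInℕ-punchOutℕ (suc c) (suc q) c≢q = ≡.cong suc (punchInℕ-punchOutℕ c q (c≢q ∘ ≡.cong suc))

punchOutℕ-< : ∀ {N} c q → c ≢ q → c ℕ.< suc N → q ℕ.< suc N → punchOutℕ c q ℕ.< N
punchOutℕ-< zero    zero    c≢q _ _ = ⊥-elim (c≢q ≡.refl)
punchOutℕ-< zero    (suc q) _   _ (s<s q<N) = q<N
punchOutℕ-< {zero}  (suc c) q       _   (s<s ()) _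
punchOutℕ-< {suc N} (suc c) zero    _   _ _ = z<s
punchOutℕ-< {suc N} (suc c) (suc q) c≢q (s<s c<N) (s<s q<N) =
  s<s (punchOutℕ-< c q (c≢q ∘ ≡.cong suc) c<N q<N)

punchOutℕ-suc : ∀ c q → c ≢ q → c ≢ suc q → punchOutℕ c (suc q) ≡ suc (punchOutℕ c q)
punchOutℕ-suc zero          zero    c≢q _    = ⊥-elim (c≢q ≡.refl)
punchOutℕ-suc zero          (suc q) _   _    = ≡.refl
punchOutℕ-suc (suc zero)    zero    _   c≢1  = ⊥-elim (c≢1 ≡.refl)
punchOutℕ-suc (suc (suc c)) zero    _   _    = ≡.refl
punchOutℕ-suc (suc c)       (suc q) c≢q c≢sq =
  ≡.cong suc (punchOutℕ-suc c q (c≢q ∘ ≡.cong suc) (c≢sq ∘ ≡.cong suc))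

punchInℕ-self : ∀ p → punchInℕ p p ≡ suc p
punchInℕ-self zero    = ≡.refl
punchInℕ-self (suc p) = ≡.cong suc (punchInℕ-self p)

punchInℕ-suc-self : ∀ p → punchInℕ (suc p) p ≡ p
punchInℕ-suc-self zero    = ≡.refl
punchInℕ-suc-self (suc p) = ≡.cong suc (punchInℕ-suc-self p)

punchInℕ-suc : ∀ p k → k ≢ p → punchInℕ (suc p) k ≡ punchInℕ p k
punchInℕ-suc zero    zero    k≢p = ⊥-elim (k≢p ≡.refl)
punchInℕ-suc zero    (suc k) _   = ≡.refl
punchInℕ-suc (suc p) zero    _   = ≡.refl
punchInℕ-suc (suc p) (suc k) k≢p = ≡.cong suc (punchInℕ-suc p k (k≢p ∘ ≡.cong suc))

punchInℕ-≢-punchOutℕ : ∀ c q k → c ≢ q → k ≢ punchOutℕ c q → punchInℕ c k ≢ q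
punchInℕ-≢-punchOutℕ c q k c≢q k≢q′ eq =
  k≢q′ (punchInℕ-injective c k (punchOutℕ c q) (≡.trans eq (≡.sym (punchInℕ-punchOutℕ c q c≢q))))

punchInℕ-suc-punchOutℕ : ∀ c p → c ≢ p → c ≢ suc p → punchInℕ c (suc (punchOutℕ c p)) ≡ suc p
punchInℕ-suc-punchOutℕ c p c≢p c≢sp =
  ≡.trans (≡.cong (punchInℕ c) (≡.sym (punchOutℕ-suc c p c≢p c≢sp)))
          (punchInℕ-punchOutℕ c (suc p) c≢sp)

plus-suc : ∀ z n → z ℤ.+ + suc n ≡ ℤ.suc (z ℤ.+ + n)
plus-suc z n = ≡.trans (ℤₚ.+-comm z (+ suc n))
                 (≡.trans (ℤₚ.suc-+ n z) (≡.cong ℤ.suc (ℤₚ.+-comm (+ n) z)))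

suc-minus-suc : ∀ z n → ℤ.suc (z ℤ.- + suc n) ≡ z ℤ.- + n
suc-minus-suc z n = ≡.trans (≡.cong ℤ.suc (ℤₚ.minus-suc z n)) (ℤₚ.suc-pred _)

toList-map-∷ʳ-++ : ∀ {a b} {A : Set a} {B : Set b} {m n} (f : A → B) (y : B) (xs : Vec A m) (ys : Vec A n) →
                   toList (map f xs ∷ʳ y) ++ toList (map f ys ∷ʳ y)
                     ≡ List.map f (toList xs) ++ y ∷ List.map f (toList ys) ++ [ y ]
toList-map-∷ʳ-++ f y xs ys = begin
  toList (map f xs ∷ʳ y) ++ toList (map f ys ∷ʳ y)
    ≡⟨ ≡.cong₂ _++_ (Vecₚ.toList-∷ʳ y (map f xs)) (Vecₚ.toList-∷ʳ y (map f ys)) ⟩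
  (toList (map f xs) ++ [ y ]) ++ toList (map f ys) ++ [ y ]
    ≡⟨ Listₚ.++-assoc (toList (map f xs)) [ y ] _ ⟩
  toList (map f xs) ++ y ∷ toList (map f ys) ++ [ y ]
    ≡⟨ ≡.cong₂ (λ us vs → us ++ y ∷ vs ++ [ y ]) (Vecₚ.toList-map f xs) (Vecₚ.toList-map f ys) ⟩
  List.map f (toList xs) ++ y ∷ List.map f (toList ys) ++ [ y ] ∎
  where open ≡.≡-Reasoning

module _ {a ℓ} (R : CommutativeRing a ℓ) where

  open CommutativeRing R hiding (zero)
  open import Relation.Binary.Reasoning.Setoid setoid
  open import Algebra.Properties.CommutativeSemigroup *-commutativeSemigroup using (x∙yz≈y∙xz)
  open import Algebra.Properties.Ring ring using (-1*x≈-x; -‿involutive; -‿+-comm; x[y-z]≈xy-xz)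
  open import Algebra.Solver.Ring.NaturalCoefficients.Default commutativeSemiring
    using (solve; _:=_; _:+_; _:*_)
  open import Algebra.Properties.Semiring.Sum semiring
    using (sum; sum-syntax; sum-cong-≋; ∑-distrib-+; *-distribˡ-sum; sum-replicate-zero)
  open import Algebra.Properties.CommutativeMonoid.Sum *-commutativeMonoid
    using ()
    renaming (sum to product; sum-cong-≋ to product-cong; sum-remove to product-remove;
              ∑-distrib-+ to product-distrib-*; sum-replicate-zero to product-replicate-one)

  private
    infixr 8 _^_
    _^_ : Carrier → ℕ → Carrier
    _^_ = pow R

    -1# : Carrier
    -1# = - 1#

  -1*-1*x≈x : ∀ x → -1# * (-1# * x) ≈ x
  -1*-1*x≈x x = begin
    -1# * (-1# * x) ≈⟨ *-assoc _ _ _ ⟨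
    (-1# * -1#) * x ≈⟨ *-congʳ (trans (-1*x≈-x -1#) (-‿involutive 1#)) ⟩
    1# * x          ≈⟨ *-identityˡ x ⟩
    x               ∎

  x+-1*x≈0 : ∀ x → x + -1# * x ≈ 0#
  x+-1*x≈0 x = trans (+-congˡ (-1*x≈-x x)) (-‿inverseʳ x)

  [x+y]-[u+v]≈[x-v]+[y-u] : ∀ x y u v → (x + y) - (u + v) ≈ (x - v) + (y - u)
  [x+y]-[u+v]≈[x-v]+[y-u] x y u v = begin
    (x + y) + - (u + v)   ≈⟨ +-congˡ (-‿+-comm u v) ⟨
    (x + y) + (- u + - v)
      ≈⟨ solve 4 (λ x y u v → (x :+ y) :+ (u :+ v) := (x :+ v) :+ (y :+ u)) refl x y (- u) (- v) ⟩
    (x + - v) + (y + - u) ∎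

  ^-homo-* : ∀ x m n → x ^ (m ℕ.+ n) ≈ x ^ m * x ^ n
  ^-homo-* x zero    n = sym (*-identityˡ _)
  ^-homo-* x (suc m) n = trans (*-congˡ (^-homo-* x m n)) (sym (*-assoc _ _ _))

  -1^n*-1^n≈1 : ∀ n → -1# ^ n * -1# ^ n ≈ 1#
  -1^n*-1^n≈1 zero    = *-identityˡ 1#
  -1^n*-1^n≈1 (suc n) = begin
    (-1# * -1# ^ n) * (-1# * -1# ^ n)
      ≈⟨ solve 2 (λ m e → (m :* e) :* (m :* e) := m :* (m :* (e :* e))) refl -1# (-1# ^ n) ⟩
    -1# * (-1# * (-1# ^ n * -1# ^ n)) ≈⟨ -1*-1*x≈x _ ⟩
    -1# ^ n * -1# ^ n                 ≈⟨ -1^n*-1^n≈1 n ⟩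
    1#                                ∎

  product-^ : ∀ {N} x (λ' : Fin N → ℕ) → product (λ i → x ^ λ' i) ≈ x ^ size λ'
  product-^ {zero}  x λ' = refl
  product-^ {suc N} x λ' =
    trans (*-congˡ (product-^ x (λ' ∘ suc))) (sym (^-homo-* x (λ' zero) _))

  sumFin≡sum : ∀ {N} (f : Fin N → Carrier) → sumFin R f ≡ sum f
  sumFin≡sum {zero}  f = ≡.refl
  sumFin≡sum {suc N} f = ≡.cong (λ s → f zero + s) (sumFin≡sum (f ∘ suc))

  sumFin-cong : ∀ {N} {f g : Fin N → Carrier} → (∀ i → f i ≈ g i) → sumFin R f ≈ sumFin R g
  sumFin-cong {f = f} {g} f≈g = begin
    sumFin R f ≡⟨ sumFin≡sum f ⟩
    sum f      ≈⟨ sum-cong-≋ f≈g ⟩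
    sum g      ≡⟨ sumFin≡sum g ⟨
    sumFin R g ∎

  sumTo-cong : ∀ k {f g : ℕ → Carrier} → (∀ j → f j ≈ g j) → sumTo R k f ≈ sumTo R k g
  sumTo-cong zero    f≈g = f≈g 0
  sumTo-cong (suc k) f≈g = +-cong (sumTo-cong k f≈g) (f≈g (suc k))

  *-distribˡ-sumTo : ∀ x k (f : ℕ → Carrier) → x * sumTo R k f ≈ sumTo R k (λ j → x * f j)
  *-distribˡ-sumTo x zero    f = refl
  *-distribˡ-sumTo x (suc k) f = trans (distribˡ x _ _) (+-congʳ (*-distribˡ-sumTo x k f))

  sumTo-suc : ∀ k (f : ℕ → Carrier) → sumTo R (suc k) f ≈ f 0 + sumTo R k (f ∘ suc)
  sumTo-suc zero    f = refl
  sumTo-suc (suc k) f = trans (+-congʳ (sumTo-suc k f)) (+-assoc _ _ _)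

  -- Complete homogeneous polynomials

  -- hN splits on the degree first, so hN R k (z ∷ Z) does not unfold for a variable k.
  hN-∷-sumTo : ∀ z Z k → hN R k (z ∷ Z) ≡ sumTo R k (λ j → z ^ j * hN R (k ℕ.∸ j) Z)
  hN-∷-sumTo z Z zero    = ≡.refl
  hN-∷-sumTo z Z (suc k) = ≡.refl

  hN-zero : ∀ Z → hN R 0 Z ≈ 1#
  hN-zero []      = refl
  hN-zero (z ∷ Z) = trans (*-identityˡ _) (hN-zero Z)

  hN-∷ : ∀ z Z k → hN R (suc k) (z ∷ Z) ≈ hN R (suc k) Z + z * hN R k (z ∷ Z)
  hN-∷ z Z k = begin
    sumTo R (suc k) (λ j → z ^ j * hN R (suc k ℕ.∸ j) Z)
      ≈⟨ sumTo-suc k _ ⟩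
    1# * hN R (suc k) Z + sumTo R k (λ j → (z * z ^ j) * hN R (k ℕ.∸ j) Z)
      ≈⟨ +-cong (*-identityˡ _) (sumTo-cong k (λ j → *-assoc z _ _)) ⟩
    hN R (suc k) Z + sumTo R k (λ j → z * (z ^ j * hN R (k ℕ.∸ j) Z))
      ≈⟨ +-congˡ (*-distribˡ-sumTo z k _) ⟨
    hN R (suc k) Z + z * sumTo R k (λ j → z ^ j * hN R (k ℕ.∸ j) Z)
      ≡⟨ ≡.cong (λ t → hN R (suc k) Z + z * t) (hN-∷-sumTo z Z k) ⟨
    hN R (suc k) Z + z * hN R k (z ∷ Z) ∎

  hN-negate : ∀ k Z → hN R k (negL R Z) ≈ -1# ^ k * hN R k Z
  hN-negate zero    Z       = trans (hN-zero (negL R Z)) (sym (trans (*-identityˡ _) (hN-zero Z)))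
  hN-negate (suc k) []      = sym (zeroʳ _)
  hN-negate (suc k) (z ∷ Z) = begin
    hN R (suc k) (- z ∷ negL R Z)
      ≈⟨ hN-∷ (- z) (negL R Z) k ⟩
    hN R (suc k) (negL R Z) + - z * hN R k (negL R (z ∷ Z))
      ≈⟨ +-cong (hN-negate (suc k) Z) (*-cong (sym (-1*x≈-x z)) (hN-negate k (z ∷ Z))) ⟩
    (-1# * -1# ^ k) * hN R (suc k) Z + (-1# * z) * (-1# ^ k * hN R k (z ∷ Z))
      ≈⟨ solve 5 (λ m e a z b → (m :* e) :* a :+ (m :* z) :* (e :* b) := (m :* e) :* (a :+ z :* b))
               refl -1# (-1# ^ k) _ z _ ⟩
    (-1# * -1# ^ k) * (hN R (suc k) Z + z * hN R k (z ∷ Z))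
      ≈⟨ *-congˡ (hN-∷ z Z k) ⟨
    -1# ^ suc k * hN R (suc k) (z ∷ Z) ∎

  hN-insert : ∀ A x B m → hN R (suc m) (A ++ x ∷ B) ≈ hN R (suc m) (A ++ B) + x * hN R m (A ++ x ∷ B)
  hN-insert []      x B m       = hN-∷ x B m
  hN-insert (a ∷ A) x B zero    = begin
    hN R 1 (a ∷ A ++ x ∷ B)
      ≈⟨ hN-∷ a (A ++ x ∷ B) 0 ⟩
    hN R 1 (A ++ x ∷ B) + a * hN R 0 (a ∷ A ++ x ∷ B)
      ≈⟨ +-congʳ (hN-insert A x B 0) ⟩
    (hN R 1 (A ++ B) + x * hN R 0 (A ++ x ∷ B)) + a * hN R 0 (a ∷ A ++ x ∷ B)
      ≈⟨ +-cong (+-congˡ (*-congˡ (hN-zero-cong (A ++ x ∷ B) (a ∷ A ++ x ∷ B))))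
                (*-congˡ (hN-zero-cong (a ∷ A ++ x ∷ B) (a ∷ A ++ B))) ⟩
    (hN R 1 (A ++ B) + x * hN R 0 (a ∷ A ++ x ∷ B)) + a * hN R 0 (a ∷ A ++ B)
      ≈⟨ solve 3 (λ p q r → (p :+ q) :+ r := (p :+ r) :+ q) refl _ _ _ ⟩
    (hN R 1 (A ++ B) + a * hN R 0 (a ∷ A ++ B)) + x * hN R 0 (a ∷ A ++ x ∷ B)
      ≈⟨ +-congʳ (hN-∷ a (A ++ B) 0) ⟨
    hN R 1 (a ∷ A ++ B) + x * hN R 0 (a ∷ A ++ x ∷ B) ∎
    where
    hN-zero-cong : ∀ Y Y′ → hN R 0 Y ≈ hN R 0 Y′
    hN-zero-cong Y Y′ = trans (hN-zero Y) (sym (hN-zero Y′))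
  hN-insert (a ∷ A) x B (suc m) = begin
    hN R (2 ℕ.+ m) (a ∷ L′)
      ≈⟨ hN-∷ a L′ (suc m) ⟩
    hN R (2 ℕ.+ m) L′ + a * hN R (suc m) (a ∷ L′)
      ≈⟨ +-cong (hN-insert A x B (suc m)) (*-congˡ (hN-insert (a ∷ A) x B m)) ⟩
    (hN R (2 ℕ.+ m) L + x * hN R (suc m) L′) + a * (hN R (suc m) (a ∷ L) + x * hN R m (a ∷ L′))
      ≈⟨ solve 6 (λ p x q a r s → (p :+ x :* q) :+ a :* (r :+ x :* s) := (p :+ a :* r) :+ x :* (q :+ a :* s))
               refl _ x _ a _ _ ⟩
    (hN R (2 ℕ.+ m) L + a * hN R (suc m) (a ∷ L)) + x * (hN R (suc m) L′ + a * hN R m (a ∷ L′))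
      ≈⟨ +-cong (hN-∷ a L (suc m)) (*-congˡ (hN-∷ a L′ m)) ⟨
    hN R (2 ℕ.+ m) (a ∷ L) + x * hN R (suc m) (a ∷ L′) ∎
    where
    L L′ : List Carrier
    L  = A ++ B
    L′ = A ++ x ∷ B

  σ : ℤ → Carrier
  σ (+ k)    = -1# ^ k
  σ -[1+ k ] = -1# ^ suc k

  σ-suc : ∀ z → σ (ℤ.suc z) ≈ -1# * σ z
  σ-suc (+ k)          = refl
  σ-suc -[1+ zero ]    = sym (-1*-1*x≈x 1#)
  σ-suc -[1+ suc k ]   = sym (-1*-1*x≈x _)

  σ-pred : ∀ z → σ (ℤ.pred z) ≈ -1# * σ z
  σ-pred (+ zero)  = refl
  σ-pred (+ suc k) = sym (-1*-1*x≈x _)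
  σ-pred -[1+ k ]  = refl

  σ-plus : ∀ z n → σ (z ℤ.+ + n) ≈ σ z * -1# ^ n
  σ-plus z zero    = trans (reflexive (≡.cong σ (ℤₚ.+-identityʳ z))) (sym (*-identityʳ _))
  σ-plus z (suc n) = begin
    σ (z ℤ.+ + suc n)       ≡⟨ ≡.cong σ (plus-suc z n) ⟩
    σ (ℤ.suc (z ℤ.+ + n))   ≈⟨ σ-suc (z ℤ.+ + n) ⟩
    -1# * σ (z ℤ.+ + n)     ≈⟨ *-congˡ (σ-plus z n) ⟩
    -1# * (σ z * -1# ^ n)   ≈⟨ x∙yz≈y∙xz _ _ _ ⟩
    σ z * (-1# * -1# ^ n)   ∎

  σ-minus : ∀ z n → σ (z ℤ.- + n) ≈ σ z * -1# ^ n
  σ-minus z zero    = σ-plus z zero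
  σ-minus z (suc n) = begin
    σ (z ℤ.- + suc n)       ≡⟨ ≡.cong σ (ℤₚ.minus-suc z n) ⟩
    σ (ℤ.pred (z ℤ.- + n))  ≈⟨ σ-pred (z ℤ.- + n) ⟩
    -1# * σ (z ℤ.- + n)     ≈⟨ *-congˡ (σ-minus z n) ⟩
    -1# * (σ z * -1# ^ n)   ≈⟨ x∙yz≈y∙xz _ _ _ ⟩
    σ z * (-1# * -1# ^ n)   ∎

  h-negate : ∀ z Z → h R z (negL R Z) ≈ σ z * h R z Z
  h-negate (+ k)    Z = hN-negate k Z
  h-negate -[1+ k ] Z = sym (zeroʳ _)

  h-remove-minus-one : ∀ A B {z} w → z ≡ ℤ.suc w →
                       h R z (A ++ B) ≈ h R z (A ++ -1# ∷ B) + h R w (A ++ -1# ∷ B)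
  h-remove-minus-one A B (+ k) ≡.refl = begin
    hN R (suc k) (A ++ B)                 ≈⟨ +-identityʳ _ ⟨
    hN R (suc k) (A ++ B) + 0#            ≈⟨ +-congˡ (x+-1*x≈0 H) ⟨
    hN R (suc k) (A ++ B) + (H + -1# * H) ≈⟨ solve 3 (λ p q r → p :+ (q :+ r) := (p :+ r) :+ q) refl _ H _ ⟩
    (hN R (suc k) (A ++ B) + -1# * H) + H ≈⟨ +-congʳ (hN-insert A -1# B k) ⟨
    hN R (suc k) (A ++ -1# ∷ B) + H       ∎
    where
    H : Carrier
    H = hN R k (A ++ -1# ∷ B)
  h-remove-minus-one A B -[1+ zero ]  ≡.refl =
    trans (hN-zero (A ++ B)) (sym (trans (+-identityʳ _) (hN-zero (A ++ -1# ∷ B))))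
  h-remove-minus-one A B -[1+ suc k ] ≡.refl = sym (+-identityʳ 0#)

  -- Determinants

  laplaceTermFin : ∀ {N} → (Fin (suc N) → Fin (suc N) → Carrier) → Fin (suc N) → Carrier
  laplaceTermFin A j = -1# ^ toℕ j * (A zero j * det R (λ a b → A (suc a) (punchIn j b)))

  det-cong : ∀ {N} {A B : Fin N → Fin N → Carrier} → (∀ i j → A i j ≈ B i j) → det R A ≈ det R B
  det-cong {zero}          _   = refl
  det-cong {suc N} {A} {B} A≈B = sumFin-cong {f = laplaceTermFin A} {g = laplaceTermFin B}
    (λ j → *-congˡ (*-cong (A≈B zero j) (det-cong (λ a b → A≈B (suc a) (punchIn j b)))))

  -- Columns are numbered by ℕ, so that neighbouring columns and column deletion are arithmetic
  -- on ℕ; the entries in columns k ≥ N are never used.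
  detℕ : ∀ N → (Fin N → ℕ → Carrier) → Carrier
  detℕ N M = det R (λ i j → M i (toℕ j))

  detℕ-cong : ∀ {N} {M M′ : Fin N → ℕ → Carrier} →
              (∀ i k → k ℕ.< N → M i k ≈ M′ i k) → detℕ N M ≈ detℕ N M′
  detℕ-cong M≈M′ = det-cong (λ i j → M≈M′ i (toℕ j) (Finₚ.toℕ<n j))

  minor : ∀ {N} → (Fin (suc N) → ℕ → Carrier) → ℕ → Fin N → ℕ → Carrier
  minor M k a k′ = M (suc a) (punchInℕ k k′)

  laplaceTerm : ∀ {N} → (Fin (suc N) → ℕ → Carrier) → ℕ → Carrier
  laplaceTerm {N} M k = -1# ^ k * (M zero k * detℕ N (minor M k))

  detℕ-expand : ∀ {N} (M : Fin (suc N) → ℕ → Carrier) →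
                detℕ (suc N) M ≈ ∑[ c < suc N ] laplaceTerm M (toℕ c)
  detℕ-expand {N} M = begin
    detℕ (suc N) M
      ≈⟨ sumFin-cong {f = laplaceTermFin (λ i j → M i (toℕ j))} {g = laplaceTerm M ∘ toℕ}
           (λ c → *-congˡ (*-congˡ (det-cong (λ a b →
                    reflexive (≡.cong (M (suc a)) (toℕ-punchIn c b)))))) ⟩
    sumFin R {suc N} (λ c → laplaceTerm M (toℕ c))
      ≡⟨ sumFin≡sum {suc N} (λ c → laplaceTerm M (toℕ c)) ⟩
    (∑[ c < suc N ] laplaceTerm M (toℕ c)) ∎

  detℕ-scale-rows : ∀ {N} (r : Fin N → Carrier) (M : Fin N → ℕ → Carrier) →
                    detℕ N (λ i k → r i * M i k) ≈ product r * detℕ N M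
  detℕ-scale-rows {zero}  r M = sym (*-identityˡ 1#)
  detℕ-scale-rows {suc N} r M = begin
    detℕ (suc N) rM
      ≈⟨ detℕ-expand rM ⟩
    (∑[ c < suc N ] laplaceTerm rM (toℕ c))
      ≈⟨ sum-cong-≋ {suc N} (λ c → scaled (toℕ c)) ⟩
    (∑[ c < suc N ] (product r * laplaceTerm M (toℕ c)))
      ≈⟨ *-distribˡ-sum {suc N} (product r) (laplaceTerm M ∘ toℕ) ⟨
    product r * (∑[ c < suc N ] laplaceTerm M (toℕ c))
      ≈⟨ *-congˡ (detℕ-expand M) ⟨
    product r * detℕ (suc N) M ∎
    where
    rM : Fin (suc N) → ℕ → Carrier
    rM i k = r i * M i k
    scaled : ∀ k → laplaceTerm rM k ≈ product r * laplaceTerm M k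
    scaled k = begin
      -1# ^ k * ((r zero * M zero k) * detℕ N (λ a k′ → r (suc a) * minor M k a k′))
        ≈⟨ *-congˡ (*-congˡ (detℕ-scale-rows (r ∘ suc) (minor M k))) ⟩
      -1# ^ k * ((r zero * M zero k) * (product (r ∘ suc) * detℕ N (minor M k)))
        ≈⟨ solve 5 (λ e r m p d → e :* ((r :* m) :* (p :* d)) := (r :* p) :* (e :* (m :* d))) refl _ _ _ _ _ ⟩
      product r * laplaceTerm M k ∎

  detℕ-scale-columns : ∀ {N} (s : ℕ → Carrier) (M : Fin N → ℕ → Carrier) →
                       detℕ N (λ i k → s k * M i k) ≈ product {N} (s ∘ toℕ) * detℕ N M
  detℕ-scale-columns {zero}  s M = sym (*-identityˡ 1#)
  detℕ-scale-columns {suc N} s M = begin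
    detℕ (suc N) sM
      ≈⟨ detℕ-expand sM ⟩
    (∑[ c < suc N ] laplaceTerm sM (toℕ c))
      ≈⟨ sum-cong-≋ {suc N} scaled ⟩
    (∑[ c < suc N ] (S * laplaceTerm M (toℕ c)))
      ≈⟨ *-distribˡ-sum {suc N} S (laplaceTerm M ∘ toℕ) ⟨
    S * (∑[ c < suc N ] laplaceTerm M (toℕ c))
      ≈⟨ *-congˡ (detℕ-expand M) ⟨
    S * detℕ (suc N) M ∎
    where
    sM : Fin (suc N) → ℕ → Carrier
    sM i k = s k * M i k
    S : Carrier
    S = product {suc N} (s ∘ toℕ)
    product-punchIn : ∀ c → s (toℕ c) * product {N} (λ j → s (punchInℕ (toℕ c) (toℕ j))) ≈ S
    product-punchIn c = sym (trans (product-remove {i = c} (s ∘ toℕ))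
                                   (*-congˡ (product-cong {N} (λ j → reflexive (≡.cong s (toℕ-punchIn c j))))))
    scaled : ∀ c → laplaceTerm sM (toℕ c) ≈ S * laplaceTerm M (toℕ c)
    scaled c = begin
      -1# ^ k * ((s k * M zero k) * detℕ N (λ a k′ → s (punchInℕ k k′) * minor M k a k′))
        ≈⟨ *-congˡ (*-congˡ (detℕ-scale-columns (s ∘ punchInℕ k) (minor M k))) ⟩
      -1# ^ k * ((s k * M zero k) * (product {N} (λ j → s (punchInℕ k (toℕ j))) * detℕ N (minor M k)))
        ≈⟨ solve 5 (λ e r m p d → e :* ((r :* m) :* (p :* d)) := (r :* p) :* (e :* (m :* d))) refl _ _ _ _ _ ⟩
      (s k * product {N} (λ j → s (punchInℕ k (toℕ j)))) * laplaceTerm M k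
        ≈⟨ *-congʳ (product-punchIn c) ⟩
      S * laplaceTerm M k ∎
      where
      k : ℕ
      k = toℕ c

  detℕ-additive : ∀ {N} q (M U V : Fin N → ℕ → Carrier) → q ℕ.< N →
                  (∀ i k → k ≢ q → M i k ≈ U i k) → (∀ i k → k ≢ q → M i k ≈ V i k) →
                  (∀ i → M i q ≈ U i q + V i q) → detℕ N M ≈ detℕ N U + detℕ N V
  detℕ-additive {suc N} q M U V q<N M≈U M≈V Mq≈Uq+Vq = begin
    detℕ (suc N) M
      ≈⟨ detℕ-expand M ⟩
    (∑[ c < suc N ] laplaceTerm M (toℕ c))
      ≈⟨ sum-cong-≋ {suc N} (λ c → additive (toℕ c) (Finₚ.toℕ<n c)) ⟩
    (∑[ c < suc N ] (laplaceTerm U (toℕ c) + laplaceTerm V (toℕ c)))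
      ≈⟨ ∑-distrib-+ {suc N} (laplaceTerm U ∘ toℕ) (laplaceTerm V ∘ toℕ) ⟩
    (∑[ c < suc N ] laplaceTerm U (toℕ c)) + (∑[ c < suc N ] laplaceTerm V (toℕ c))
      ≈⟨ +-cong (detℕ-expand U) (detℕ-expand V) ⟨
    detℕ (suc N) U + detℕ (suc N) V ∎
    where
    additive : ∀ k → k ℕ.< suc N → laplaceTerm M k ≈ laplaceTerm U k + laplaceTerm V k
    additive k k<N with k ℕ.≟ q
    ... | yes ≡.refl = begin
      -1# ^ k * (M zero k * detℕ N (minor M k))
        ≈⟨ *-congˡ (*-congʳ (Mq≈Uq+Vq zero)) ⟩
      -1# ^ k * ((U zero k + V zero k) * detℕ N (minor M k))
        ≈⟨ solve 4 (λ e u v d → e :* ((u :+ v) :* d) := e :* (u :* d) :+ e :* (v :* d)) refl _ _ _ _ ⟩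
      -1# ^ k * (U zero k * detℕ N (minor M k)) + -1# ^ k * (V zero k * detℕ N (minor M k))
        ≈⟨ +-cong (*-congˡ (*-congˡ (minor-cong M≈U))) (*-congˡ (*-congˡ (minor-cong M≈V))) ⟩
      laplaceTerm U k + laplaceTerm V k ∎
      where
      minor-cong : ∀ {W} → (∀ i k′ → k′ ≢ k → M i k′ ≈ W i k′) →
                   detℕ N (minor M k) ≈ detℕ N (minor W k)
      minor-cong M≈W = detℕ-cong (λ a k′ _ → M≈W (suc a) _ (punchInℕᵢ≢i k k′))
    ... | no k≢q = begin
      -1# ^ k * (M zero k * detℕ N (minor M k))
        ≈⟨ *-congˡ (*-congˡ (detℕ-additive q′ (minor M k) (minor U k) (minor V k) q′<N
                               (λ a k′ → M≈U (suc a) _ ∘ punchInℕ-≢-punchOutℕ k q k′ k≢q)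
                               (λ a k′ → M≈V (suc a) _ ∘ punchInℕ-≢-punchOutℕ k q k′ k≢q)
                               (λ a → ≡.subst (λ t → M (suc a) t ≈ U (suc a) t + V (suc a) t)
                                              (≡.sym (punchInℕ-punchOutℕ k q k≢q)) (Mq≈Uq+Vq (suc a))))) ⟩
      -1# ^ k * (M zero k * (detℕ N (minor U k) + detℕ N (minor V k)))
        ≈⟨ solve 4 (λ e m u v → e :* (m :* (u :+ v)) := e :* (m :* u) :+ e :* (m :* v)) refl _ _ _ _ ⟩
      -1# ^ k * (M zero k * detℕ N (minor U k)) + -1# ^ k * (M zero k * detℕ N (minor V k))
        ≈⟨ +-cong (*-congˡ (*-congʳ (M≈U zero k k≢q))) (*-congˡ (*-congʳ (M≈V zero k k≢q))) ⟩
      laplaceTerm U k + laplaceTerm V k ∎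
      where
      q′ : ℕ
      q′ = punchOutℕ k q
      q′<N : q′ ℕ.< N
      q′<N = punchOutℕ-< k q k≢q k<N q<N

  sum-cancelling-pair : ∀ {N} p (F : ℕ → Carrier) → suc p ℕ.< N →
                        (∀ k → k ℕ.< N → k ≢ p → k ≢ suc p → F k ≈ 0#) → F p + F (suc p) ≈ 0# →
                        (∑[ c < N ] F (toℕ c)) ≈ 0#
  sum-cancelling-pair {suc zero}    zero    F (s<s ())
  sum-cancelling-pair {suc (suc N)} zero    F _ F≈0 pair = begin
    F 0 + (F 1 + rest)  ≈⟨ +-assoc _ _ _ ⟨
    (F 0 + F 1) + rest  ≈⟨ +-cong pair rest≈0 ⟩
    0# + 0#             ≈⟨ +-identityʳ 0# ⟩
    0#                  ∎
    where
    rest : Carrier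
    rest = ∑[ c < N ] F (suc (suc (toℕ c)))
    rest≈0 : rest ≈ 0#
    rest≈0 = trans (sum-cong-≋ (λ c → F≈0 _ (s<s (s<s (Finₚ.toℕ<n c))) (λ ()) (λ ())))
                   (sum-replicate-zero N)
  sum-cancelling-pair {suc N} (suc p) F (s<s sp<N) F≈0 pair = begin
    F 0 + (∑[ c < N ] F (suc (toℕ c)))
      ≈⟨ +-cong (F≈0 0 z<s (λ ()) (λ ())) (sum-cancelling-pair p (F ∘ suc) sp<N F∘suc≈0 pair) ⟩
    0# + 0#
      ≈⟨ +-identityʳ 0# ⟩
    0# ∎
    where
    F∘suc≈0 : ∀ k → k ℕ.< N → k ≢ p → k ≢ suc p → F (suc k) ≈ 0#
    F∘suc≈0 k k<N k≢p k≢sp =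
      F≈0 (suc k) (s<s k<N) (k≢p ∘ ℕₚ.suc-injective) (k≢sp ∘ ℕₚ.suc-injective)

  minor-adjacent : ∀ {N} p (M : Fin (suc N) → ℕ → Carrier) → (∀ i → M i p ≈ M i (suc p)) →
                   ∀ a k′ → minor M p a k′ ≈ minor M (suc p) a k′
  minor-adjacent p M Mp≈Msp a k′ with k′ ℕ.≟ p
  ... | yes ≡.refl rewrite punchInℕ-self k′ | punchInℕ-suc-self k′ = sym (Mp≈Msp (suc a))
  ... | no  k′≢p = reflexive (≡.cong (M (suc a)) (≡.sym (punchInℕ-suc p k′ k′≢p)))

  detℕ-equal-adjacent-columns : ∀ {N} p (M : Fin N → ℕ → Carrier) → suc p ℕ.< N →
                                (∀ i → M i p ≈ M i (suc p)) → detℕ N M ≈ 0#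
  detℕ-equal-adjacent-columns {suc N} p M sp<N Mp≈Msp =
    trans (detℕ-expand M) (sum-cancelling-pair p (laplaceTerm M) sp<N vanishes cancels)
    where
    vanishes : ∀ k → k ℕ.< suc N → k ≢ p → k ≢ suc p → laplaceTerm M k ≈ 0#
    vanishes k k<N k≢p k≢sp = begin
      -1# ^ k * (M zero k * detℕ N (minor M k))
        ≈⟨ *-congˡ (*-congˡ (detℕ-equal-adjacent-columns p′ (minor M k) sp′<N equal)) ⟩
      -1# ^ k * (M zero k * 0#)  ≈⟨ *-congˡ (zeroʳ _) ⟩
      -1# ^ k * 0#               ≈⟨ zeroʳ _ ⟩
      0#                         ∎
      where
      p′ : ℕ
      p′ = punchOutℕ k p
      sp′<N : suc p′ ℕ.< N
      sp′<N = ≡.subst (ℕ._< N) (punchOutℕ-suc k p k≢p k≢sp) (punchOutℕ-< k (suc p) k≢sp k<N sp<N)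
      equal : ∀ a → minor M k a p′ ≈ minor M k a (suc p′)
      equal a = ≡.subst₂ (λ s t → M (suc a) s ≈ M (suc a) t)
                         (≡.sym (punchInℕ-punchOutℕ k p k≢p))
                         (≡.sym (punchInℕ-suc-punchOutℕ k p k≢p k≢sp))
                         (Mp≈Msp (suc a))
    cancels : laplaceTerm M p + laplaceTerm M (suc p) ≈ 0#
    cancels = begin
      t + (-1# * -1# ^ p) * (M zero (suc p) * detℕ N (minor M (suc p)))
        ≈⟨ +-congˡ (*-congˡ (*-cong (sym (Mp≈Msp zero))
                                    (detℕ-cong (λ a k′ _ → sym (minor-adjacent p M Mp≈Msp a k′))))) ⟩
      t + (-1# * -1# ^ p) * (M zero p * detℕ N (minor M p))
        ≈⟨ +-congˡ (*-assoc _ _ _) ⟩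
      t + -1# * t
        ≈⟨ x+-1*x≈0 t ⟩
      0# ∎
      where
      t : Carrier
      t = laplaceTerm M p

  detℕ-add-column-to-next : ∀ {N} p (M M′ : Fin N → ℕ → Carrier) → suc p ℕ.< N →
                            (∀ i k → k ≢ suc p → M′ i k ≈ M i k) →
                            (∀ i → M′ i (suc p) ≈ M i (suc p) + M i p) →
                            detℕ N M′ ≈ detℕ N M
  detℕ-add-column-to-next {N} p M M′ sp<N M′≈M M′sp≈Msp+Mp = begin
    detℕ N M′             ≈⟨ detℕ-additive (suc p) M′ M V sp<N M′≈M M′≈V M′sp≈Msp+Vsp ⟩
    detℕ N M + detℕ N V   ≈⟨ +-congˡ (detℕ-equal-adjacent-columns p V sp<N V-equal) ⟩
    detℕ N M + 0#         ≈⟨ +-identityʳ _ ⟩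
    detℕ N M              ∎
    where
    V : Fin N → ℕ → Carrier
    V i k with k ℕ.≟ suc p
    ... | yes _ = M i p
    ... | no  _ = M i k
    V-off : ∀ i k → k ≢ suc p → V i k ≡ M i k
    V-off i k k≢sp with k ℕ.≟ suc p
    ... | yes k≡sp = ⊥-elim (k≢sp k≡sp)
    ... | no  _    = ≡.refl
    V-at : ∀ i → V i (suc p) ≡ M i p
    V-at i with suc p ℕ.≟ suc p
    ... | yes _  = ≡.refl
    ... | no  ne = ⊥-elim (ne ≡.refl)
    M′≈V : ∀ i k → k ≢ suc p → M′ i k ≈ V i k
    M′≈V i k k≢sp = trans (M′≈M i k k≢sp) (reflexive (≡.sym (V-off i k k≢sp)))
    M′sp≈Msp+Vsp : ∀ i → M′ i (suc p) ≈ M i (suc p) + V i (suc p)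
    M′sp≈Msp+Vsp i = trans (M′sp≈Msp+Mp i) (+-congˡ (reflexive (≡.sym (V-at i))))
    V-equal : ∀ i → V i p ≈ V i (suc p)
    V-equal i = reflexive (≡.trans (V-off i p (ℕₚ.1+n≢n ∘ ≡.sym)) (≡.sym (V-at i)))

  -- shearFrom m f k = f k + f (k - 1) for k > m, and f k for k ≤ m.
  shearFrom : ℕ → (ℕ → Carrier) → ℕ → Carrier
  shearFrom zero    f zero    = f zero
  shearFrom zero    f (suc k) = f (suc k) + f k
  shearFrom (suc m) f zero    = f zero
  shearFrom (suc m) f (suc k) = shearFrom m (f ∘ suc) k

  shearFrom-≤ : ∀ m f k → k ℕ.≤ m → shearFrom m f k ≡ f k
  shearFrom-≤ zero    f zero    _         = ≡.refl
  shearFrom-≤ (suc m) f zero    _         = ≡.refl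
  shearFrom-≤ (suc m) f (suc k) (s≤s k≤m) = shearFrom-≤ m (f ∘ suc) k k≤m

  shearFrom-suc : ∀ m f → shearFrom m f (suc m) ≡ f (suc m) + f m
  shearFrom-suc zero    f = ≡.refl
  shearFrom-suc (suc m) f = shearFrom-suc m (f ∘ suc)

  shearFrom-≢ : ∀ m f k → k ≢ suc m → shearFrom m f k ≡ shearFrom (suc m) f k
  shearFrom-≢ zero    f zero          _   = ≡.refl
  shearFrom-≢ zero    f (suc zero)    k≢1 = ⊥-elim (k≢1 ≡.refl)
  shearFrom-≢ zero    f (suc (suc k)) _   = ≡.refl
  shearFrom-≢ (suc m) f zero          _   = ≡.refl
  shearFrom-≢ (suc m) f (suc k)       k≢  = shearFrom-≢ m (f ∘ suc) k (k≢ ∘ ≡.cong suc)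

  detℕ-shearFrom-suc : ∀ {N} m (M : Fin N → ℕ → Carrier) →
                       detℕ N (λ i → shearFrom m (M i)) ≈ detℕ N (λ i → shearFrom (suc m) (M i))
  detℕ-shearFrom-suc {N} m M with suc m ℕ.<? N
  ... | yes sm<N = detℕ-add-column-to-next m _ _ sm<N
    (λ i k k≢sm → reflexive (shearFrom-≢ m (M i) k k≢sm))
    (λ i → begin
      shearFrom m (M i) (suc m)           ≡⟨ shearFrom-suc m (M i) ⟩
      M i (suc m) + M i m                 ≡⟨ ≡.cong₂ _+_ (shearFrom-≤ (suc m) (M i) (suc m) ℕₚ.≤-refl)
                                                         (shearFrom-≤ (suc m) (M i) m (ℕₚ.n≤1+n m)) ⟨
      shearFrom (suc m) (M i) (suc m) + shearFrom (suc m) (M i) m ∎)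
  ... | no  sm≮N = detℕ-cong (λ i k k<N →
    reflexive (shearFrom-≢ m (M i) k (λ k≡sm → sm≮N (≡.subst (ℕ._< N) k≡sm k<N))))

  detℕ-shear : ∀ {N} (M : Fin N → ℕ → Carrier) → detℕ N (λ i → shearFrom 0 (M i)) ≈ detℕ N M
  detℕ-shear {N} M =
    trans (shifted N) (detℕ-cong (λ i k k<N → reflexive (shearFrom-≤ N (M i) k (ℕₚ.<⇒≤ k<N))))
    where
    shifted : ∀ m → detℕ N (λ i → shearFrom 0 (M i)) ≈ detℕ N (λ i → shearFrom m (M i))
    shifted zero    = refl
    shifted (suc m) = trans (shifted m) (detℕ-shearFrom-suc m M)

  -- The matrices of orth R λ' Z and soMinus R λ' Z are, by definition, the matrices of rows
  -- oRow (rowIndex λ' i) Z and soRow (rowIndex λ' i) Z; column k stands for j = k + 1.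
  rowIndex : ∀ {N} → (Fin N → ℕ) → Fin N → ℤ
  rowIndex λ' i = + λ' i ℤ.- + suc (toℕ i)

  oRow soRow : ℤ → List Carrier → ℕ → Carrier
  oRow  a Z k = h R (a ℤ.+ + suc k) Z - h R (a ℤ.- + suc k) Z
  soRow a Z k = h R (a ℤ.+ + suc k) Z - h R (a ℤ.- + k) Z

  oRow-negate : ∀ a Z k → oRow a (negL R Z) k ≈ σ a * (-1# ^ suc k * oRow a Z k)
  oRow-negate a Z k = begin
    h R (a ℤ.+ + suc k) (negL R Z) - h R (a ℤ.- + suc k) (negL R Z)
      ≈⟨ +-cong (h-negate (a ℤ.+ + suc k) Z) (-‿cong (h-negate (a ℤ.- + suc k) Z)) ⟩
    σ (a ℤ.+ + suc k) * h R (a ℤ.+ + suc k) Z - σ (a ℤ.- + suc k) * h R (a ℤ.- + suc k) Z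
      ≈⟨ +-cong (*-congʳ (σ-plus a (suc k))) (-‿cong (*-congʳ (σ-minus a (suc k)))) ⟩
    (σ a * -1# ^ suc k) * h R (a ℤ.+ + suc k) Z - (σ a * -1# ^ suc k) * h R (a ℤ.- + suc k) Z
      ≈⟨ x[y-z]≈xy-xz _ _ _ ⟨
    (σ a * -1# ^ suc k) * oRow a Z k
      ≈⟨ *-assoc _ _ _ ⟩
    σ a * (-1# ^ suc k * oRow a Z k) ∎

  product-signs : ∀ {N} (λ' : Fin N → ℕ) →
                  product (σ ∘ rowIndex λ') * product {N} (λ i → -1# ^ suc (toℕ i)) ≈ -1# ^ size λ'
  product-signs {N} λ' = begin
    product (σ ∘ rowIndex λ') * C
      ≈⟨ *-congʳ (product-cong (λ i → σ-minus (+ λ' i) (suc (toℕ i)))) ⟩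
    product (λ i → -1# ^ λ' i * c i) * C
      ≈⟨ *-congʳ (product-distrib-* _ c) ⟩
    (product (λ i → -1# ^ λ' i) * C) * C
      ≈⟨ *-assoc _ _ _ ⟩
    product (λ i → -1# ^ λ' i) * (C * C)
      ≈⟨ *-congˡ (product-distrib-* c c) ⟨
    product (λ i → -1# ^ λ' i) * product (λ i → c i * c i)
      ≈⟨ *-congˡ (trans (product-cong {N} (λ i → -1^n*-1^n≈1 (suc (toℕ i)))) (product-replicate-one N)) ⟩
    product (λ i → -1# ^ λ' i) * 1#
      ≈⟨ *-identityʳ _ ⟩
    product (λ i → -1# ^ λ' i)
      ≈⟨ product-^ -1# λ' ⟩
    -1# ^ size λ' ∎
    where
    c : Fin N → Carrier
    c i = -1# ^ suc (toℕ i)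
    C : Carrier
    C = product c

  orth-negate : ∀ {N} (λ' : Fin N → ℕ) Z → orth R λ' (negL R Z) ≈ -1# ^ size λ' * orth R λ' Z
  orth-negate {N} λ' Z = begin
    detℕ N (λ i → oRow (rowIndex λ' i) (negL R Z))
      ≈⟨ detℕ-cong (λ i k _ → oRow-negate (rowIndex λ' i) Z k) ⟩
    detℕ N (λ i k → σ (rowIndex λ' i) * (-1# ^ suc k * oRow (rowIndex λ' i) Z k))
      ≈⟨ detℕ-scale-rows (σ ∘ rowIndex λ') (λ i k → -1# ^ suc k * oRow (rowIndex λ' i) Z k) ⟩
    product (σ ∘ rowIndex λ') * detℕ N (λ i k → -1# ^ suc k * oRow (rowIndex λ' i) Z k)
      ≈⟨ *-congˡ (detℕ-scale-columns {N} (λ k → -1# ^ suc k) (λ i → oRow (rowIndex λ' i) Z)) ⟩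
    product (σ ∘ rowIndex λ') * (product {N} (λ i → -1# ^ suc (toℕ i)) * orth R λ' Z)
      ≈⟨ *-assoc _ _ _ ⟨
    (product (σ ∘ rowIndex λ') * product {N} (λ i → -1# ^ suc (toℕ i))) * orth R λ' Z
      ≈⟨ *-congʳ (product-signs λ') ⟩
    -1# ^ size λ' * orth R λ' Z ∎

  soRow-shear : ∀ A B a k → soRow a (A ++ B) k ≈ shearFrom 0 (oRow a (A ++ -1# ∷ B)) k
  soRow-shear A B a zero = begin
    h R (a ℤ.+ + 1) (A ++ B) - h R (a ℤ.- + 0) (A ++ B)
      ≈⟨ +-cong (h-remove-minus-one A B (a ℤ.+ + 0) (plus-suc a 0))
                (-‿cong (h-remove-minus-one A B (a ℤ.- + 1) (≡.sym (suc-minus-suc a 0)))) ⟩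
    (H (a ℤ.+ + 1) + H (a ℤ.+ + 0)) - (H (a ℤ.- + 0) + H (a ℤ.- + 1))
      ≈⟨ [x+y]-[u+v]≈[x-v]+[y-u] _ _ _ _ ⟩
    (H (a ℤ.+ + 1) - H (a ℤ.- + 1)) + (H (a ℤ.+ + 0) - H (a ℤ.- + 0))
      ≈⟨ +-congˡ (-‿inverseʳ _) ⟩
    (H (a ℤ.+ + 1) - H (a ℤ.- + 1)) + 0#
      ≈⟨ +-identityʳ _ ⟩
    oRow a (A ++ -1# ∷ B) 0 ∎
    where
    H : ℤ → Carrier
    H z = h R z (A ++ -1# ∷ B)
  soRow-shear A B a (suc k) = begin
    h R (a ℤ.+ + suc (suc k)) (A ++ B) - h R (a ℤ.- + suc k) (A ++ B)
      ≈⟨ +-cong (h-remove-minus-one A B (a ℤ.+ + suc k) (plus-suc a (suc k)))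
                (-‿cong (h-remove-minus-one A B (a ℤ.- + suc (suc k)) (≡.sym (suc-minus-suc a (suc k))))) ⟩
    (H (a ℤ.+ + suc (suc k)) + H (a ℤ.+ + suc k)) - (H (a ℤ.- + suc k) + H (a ℤ.- + suc (suc k)))
      ≈⟨ [x+y]-[u+v]≈[x-v]+[y-u] _ _ _ _ ⟩
    oRow a (A ++ -1# ∷ B) (suc k) + oRow a (A ++ -1# ∷ B) k ∎
    where
    H : ℤ → Carrier
    H z = h R z (A ++ -1# ∷ B)

  soMinus≈orth-∷-1 : ∀ {N} (λ' : Fin N → ℕ) A B → soMinus R λ' (A ++ B) ≈ orth R λ' (A ++ -1# ∷ B)
  soMinus≈orth-∷-1 {N} λ' A B = begin
    detℕ N (λ i → soRow (rowIndex λ' i) (A ++ B))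
      ≈⟨ detℕ-cong (λ i k _ → soRow-shear A B (rowIndex λ' i) k) ⟩
    detℕ N (λ i → shearFrom 0 (oRow (rowIndex λ' i) (A ++ -1# ∷ B)))
      ≈⟨ detℕ-shear (λ i → oRow (rowIndex λ' i) (A ++ -1# ∷ B)) ⟩
    detℕ N (λ i → oRow (rowIndex λ' i) (A ++ -1# ∷ B)) ∎

lemma3p4 : ∀ {c ℓ} (R : CommutativeRing c ℓ) → let open CommutativeRing R in
    (n : ℕ) (X Xbar : Vec Carrier n) →
    (∀ (i : Fin n) → lookup X i * lookup Xbar i ≈ 1#) →
    ((λ' : Fin n → ℕ) → IsPartition λ' →
      orth R λ' (negL R (toList X ++ toList Xbar ++ [ 1# ]))
        ≈ pow R (- 1#) (size λ') * oo R λ' X Xbar)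
    ×
    ((λ' : Fin (suc n) → ℕ) → IsPartition λ' →
      soMinus R λ' (negL R (toList X ++ toList Xbar ++ [ 1# ]))
        ≈ oe R λ' (map (λ z → - z) X ∷ʳ - 1#) (map (λ z → - z) Xbar ∷ʳ - 1#))
lemma3p4 R n X Xbar _ =
    (λ λ' _ → orth-negate R λ' Z)
  , (λ λ' _ → begin
      soMinus R λ' (negL R Z)       ≡⟨ ≡.cong (soMinus R λ') negZ≡A++B ⟩
      soMinus R λ' (A ++ B)         ≈⟨ soMinus≈orth-∷-1 R λ' A B ⟩
      orth R λ' (A ++ - 1# ∷ B)     ≡⟨ ≡.cong (orth R λ') (toList-map-∷ʳ-++ -_ (- 1#) X Xbar) ⟨
      oe R λ' (map -_ X ∷ʳ - 1#) (map -_ Xbar ∷ʳ - 1#) ∎)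
  where
  open CommutativeRing R
  open import Relation.Binary.Reasoning.Setoid setoid
  Z A B : List Carrier
  Z = toList X ++ toList Xbar ++ [ 1# ]
  A = negL R (toList X)
  B = negL R (toList Xbar) ++ [ - 1# ]
  negZ≡A++B : negL R Z ≡ A ++ B
  negZ≡A++B = ≡.trans (Listₚ.map-++ -_ (toList X) _) (≡.cong (A ++_) (Listₚ.map-++ -_ (toList Xbar) [ 1# ]))
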